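{- Let $p$ and $i$ be nonnegative integers with $p\ge2$, and let $G$ be a $2$-connected graph in $\mathcal{C}_{2p+i,3p+i}$. Then: (i) the distillation $D(G)$ has at most $3p$ edges and minimum degree $\delta(D(G))\ge3$; (ii) if $D(G)$ has exactly $3p$ edges, then $D(G)$ is cubic; (iii) $G$ has at most $3p$ chains, with equality if and only if $D(G)$ is cubic.
   Context: $\mathcal{C}_{n,m}$ is the class of connected simple graphs on $n$ vertices and $m$ edges. A simple graph is $2$-connected if it has at least 3 vertices, is connected, and remains connected after deleting any single vertex. For a $2$-connected simple graph $G$ with more edges than vertices, a chain is the edge set of a path $P$ in $G$ whose two (distinct) endpoints have degree greater than $2$ in $G$ and whose internal vertices (if any) all have degree $2$ in $G$. Collapsing a chain means removing its edges and internal vertices and adding an edge joining its two endpoints. The distillation $D(G)$ is the (possibly multi-)graph obtained from $G$ by collapsing all its chains. -}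

module Defs where

open import Data.Nat using (ℕ; zero; suc; _+_; _*_; _≤_; _<_)
open import Data.Fin using (Fin; zero; suc; inject₁; fromℕ; _≟_)
open import Data.Fin.Properties using ()
open import Data.Product using (Σ; ∃; ∃-syntax; _×_; _,_; proj₁; proj₂)
open import Data.Sum using (_⊎_)
open import Data.Unit using (⊤)
open import Data.List using (List; []; _∷_; length; map; _++_; allFin)
open import Data.Nat.ListAction using (sum)
open import Data.List.Membership.Propositional using (_∈_)
open import Data.List.Relation.Unary.Unique.Propositional using (Unique)
open import Data.List.Relation.Binary.Pointwise using ()
open import Relation.Nullary using (¬_; yes; no)
open import Relation.Binary.PropositionalEquality using (_≡_; _≢_)
open import Function.Bundles using (_⇔_)
open import Function.Definitions using (Injective)

SameEnds : {n : ℕ} → Fin n × Fin n → Fin n × Fin n → Set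
SameEnds (a , b) (c , d) = (a ≡ c × b ≡ d) ⊎ (a ≡ d × b ≡ c)

record SimpleGraph (n m : ℕ) : Set where
  field
    ends     : Fin m → Fin n × Fin n
    loopless : ∀ e → proj₁ (ends e) ≢ proj₂ (ends e)
    noMulti  : ∀ e f → SameEnds (ends e) (ends f) → e ≡ f
open SimpleGraph public

-- number of times vertex v occurs as an endpoint of a (multi)edge (u , w)
-- (a loop would count twice)
hits : {n : ℕ} → Fin n → Fin n × Fin n → ℕ
hits v (u , w) = is u + is w
  where
  is : _ → ℕ
  is x with x ≟ v
  ... | yes _ = 1
  ... | no  _ = 0

degIn : {n : ℕ} → List (Fin n × Fin n) → Fin n → ℕ
degIn es v = sum (map (hits v) es)

edgeList : {n m : ℕ} → SimpleGraph n m → List (Fin n × Fin n)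
edgeList {m = m} G = map (ends G) (allFin m)

deg : {n m : ℕ} → SimpleGraph n m → Fin n → ℕ
deg G v = degIn (edgeList G) v

Adj : {n m : ℕ} → SimpleGraph n m → Fin n → Fin n → Set
Adj G u v = ∃[ e ] SameEnds (ends G e) (u , v)

data WalkIn {n m : ℕ} (G : SimpleGraph n m) (P : Fin n → Set) : Fin n → Fin n → Set where
  here : ∀ {u} → P u → WalkIn G P u u
  step : ∀ {u w v} → P u → Adj G u w → WalkIn G P w v → WalkIn G P u v

Connected : {n m : ℕ} → SimpleGraph n m → Set
Connected G = ∀ u v → WalkIn G (λ _ → ⊤) u v

ConnectedWithout : {n m : ℕ} → SimpleGraph n m → Fin n → Set
ConnectedWithout G x = ∀ u v → u ≢ x → v ≢ x → WalkIn G (λ w → w ≢ x) u v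

TwoConnected : {n m : ℕ} → SimpleGraph n m → Set
TwoConnected {n} G = 3 ≤ n × Connected G × (∀ x → ConnectedWithout G x)

record ChainPath {n m : ℕ} (G : SimpleGraph n m) : Set where
  field
    k        : ℕ
    vs       : Fin (suc (suc k)) → Fin n
    distinct : Injective _≡_ _≡_ vs
    adjacent : ∀ (j : Fin (suc k)) → Adj G (vs (inject₁ j)) (vs (suc j))
    startDeg : 2 < deg G (vs zero)
    endDeg   : 2 < deg G (vs (fromℕ (suc k)))
    innerDeg : ∀ (j : Fin k) → deg G (vs (suc (inject₁ j))) ≡ 2
open ChainPath public

InPath : {n m : ℕ} {G : SimpleGraph n m} → ChainPath G → Fin m → Set
InPath {G = G} P e =
  ∃[ j ] SameEnds (ends G e) (vs P (inject₁ j) , vs P (suc j))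

-- two paths have the same edge set (i.e. determine the same chain)
SameChain : {n m : ℕ} {G : SimpleGraph n m} → ChainPath G → ChainPath G → Set
SameChain {m = m} P Q = ∀ (e : Fin m) → InPath P e ⇔ InPath Q e

Internal : {n m : ℕ} {G : SimpleGraph n m} → ChainPath G → Fin n → Set
Internal P v = ∃[ j ] vs P (suc (inject₁ j)) ≡ v

pathEnds : {n m : ℕ} {G : SimpleGraph n m} → ChainPath G → Fin n × Fin n
pathEnds P = vs P zero , vs P (fromℕ (suc (k P)))

data _At_≔_ {A : Set} : List A → ℕ → A → Set where
  at0 : ∀ {x xs} → (x ∷ xs) At 0 ≔ x
  atS : ∀ {x y xs i} → xs At i ≔ y → (x ∷ xs) At suc i ≔ y

-- The distillation, together with an enumeration of the chains.
--  * chains : one path for each chain of G (distinct entries are distinct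
--    chains, and every chain occurs), so the number of chains of G is
--    length chains;
--  * free   : the edges of G lying in no chain (without repetition);
--  * verts  : the vertices of G that are internal to no chain
--             (without repetition) = vertex set of D(G).
-- The edges of D(G) are: one edge joining the endpoints of each chain,
-- plus the edges of G lying in no chain.
record Distillation {n m : ℕ} (G : SimpleGraph n m) : Set where
  field
    chains         : List (ChainPath G)
    chainsDistinct : ∀ i j P Q → chains At i ≔ P → chains At j ≔ Q →
                     SameChain P Q → i ≡ j
    chainsComplete : ∀ (Q : ChainPath G) → ∃[ P ] (P ∈ chains × SameChain P Q)
    free           : List (Fin m)
    freeUnique     : Unique free
    freeSpec       : ∀ e → e ∈ free ⇔ (∀ (Q : ChainPath G) → ¬ InPath Q e)
    verts          : List (Fin n)
    vertsUnique    : Unique verts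
    vertsSpec      : ∀ v → v ∈ verts ⇔ (∀ (Q : ChainPath G) → ¬ Internal Q v)
open Distillation public

numChains : {n m : ℕ} {G : SimpleGraph n m} → Distillation G → ℕ
numChains D = length (chains D)

edgesD : {n m : ℕ} {G : SimpleGraph n m} → Distillation G → List (Fin n × Fin n)
edgesD {G = G} D = map pathEnds (chains D) ++ map (ends G) (free D)

numEdgesD : {n m : ℕ} {G : SimpleGraph n m} → Distillation G → ℕ
numEdgesD D = length (edgesD D)

degD : {n m : ℕ} {G : SimpleGraph n m} → Distillation G → Fin n → ℕ
degD D v = degIn (edgesD D) v

MinDegD≥3 : {n m : ℕ} {G : SimpleGraph n m} → Distillation G → Set
MinDegD≥3 D = ∀ v → v ∈ verts D → 3 ≤ degD D v

CubicD : {n m : ℕ} {G : SimpleGraph n m} → Distillation G → Set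
CubicD D = ∀ v → v ∈ verts D → degD D v ≡ 3

-- Every edge of G lies in exactly one chain: grow it through degree-2 vertices at both ends.  The
-- growth cannot run into itself, since a bare path closed up by an edge at a degree-2 end would, by
-- 2-connectivity, be all of G, making G a cycle with m = n, whereas m - n = p > 0.  Hence D(G) has
-- exactly one edge per chain, its vertices are the n₃ vertices of G of degree ≥ 3, and these keep
-- their degrees.  Counting degrees in G gives 2m = 2c + 2(n - n₃) for the number c of chains, so
-- c = p + n₃, while counting in D(G) gives 3n₃ ≤ 2c = 2p + 2n₃.  Thus n₃ ≤ 2p and c ≤ 3p, with
-- equality iff every vertex of D(G) has degree exactly 3.

{-# OPTIONS --safe #-}
module Submission where

open import Defs
open import Data.Nat using (ℕ; zero; suc; _+_; _*_; _≤_; _<_; _≤?_; _<?_; z≤n; s≤s; z<s)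
open import Data.Nat.Properties as ℕ
  using ( +-*-semiring; ≤-trans; ≤-antisym; ≤-reflexive; <-irrefl; ≮⇒≥; +-mono-≤; +-monoʳ-≤; m≤m+n; m≤n+m
        ; +-suc; +-assoc; +-cancelˡ-≡; +-cancelʳ-≡; +-cancelʳ-≤; +-cancelˡ-<)
open import Data.Nat.Tactic.RingSolver using (solve-∀)
import Data.Nat.ListAction as List
open import Data.Fin using (Fin; zero; suc; inject₁; fromℕ; toℕ; opposite; punchIn; punchOut; _≟_)
open import Data.Fin.Properties
  using ( punchInᵢ≢i; punchIn-punchOut; punchIn-injective; punchOut-injective; toℕ-inject₁; inject₁-injective
        ; suc-injective; fromℕ≢inject₁; opposite-involutive; injective⇒≤; any?; all?)
open import Data.Fin.Relation.Unary.Top using (view; ‵fromℕ; ‵inject₁)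
open import Data.Vec.Functional using (Vector; removeAt)
open import Data.List using (List; []; _∷_; length; map; tabulate; allFin; filter; deduplicate; _++_)
open import Data.List.Properties using (map-∘; map-cong; length-map; length-tabulate; ++-identityʳ)
open import Data.List.Relation.Unary.Any using (Any; here; there)
import Data.List.Relation.Unary.Any.Properties as Any
import Data.List.Relation.Unary.All as All
open import Data.List.Relation.Unary.AllPairs using (AllPairs; []; _∷_)
open import Data.List.Membership.Propositional using (_∈_; find; lose)
open import Data.List.Membership.Propositional.Properties using (∈-filter⁺; ∈-filter⁻; ∈-allFin)
open import Data.List.Relation.Unary.Unique.Propositional.Properties using (filter⁺; allFin⁺)
open import Data.List.Relation.Unary.Unique.DecSetoid.Properties using (deduplicate-!)
open import Data.Product using (∃-syntax; _×_; _,_; proj₁; proj₂; uncurry)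
open import Data.Sum using (_⊎_; inj₁; inj₂; [_,_]′; swap)
open import Data.Empty using (⊥; ⊥-elim)
open import Data.Unit using (⊤)
open import Level using (0ℓ)
open import Relation.Nullary using (¬_; Dec; yes; no; ¬?)
open import Relation.Nullary.Decidable using (map′; _×-dec_; _⊎-dec_; _→-dec_)
open import Relation.Binary using (Rel; Symmetric; IsEquivalence; DecSetoid)
import Relation.Binary.Definitions as B
open import Relation.Binary.PropositionalEquality
  using (_≡_; _≢_; refl; sym; trans; cong; cong₂; subst; subst₂; module ≡-Reasoning)
open import Function using (_∘_; id)
open import Function.Definitions using (Injective)
open import Function.Bundles using (_⇔_; mk⇔; Equivalence)
import Function.Properties.Equivalence as ⇔
open import Algebra.Properties.Semiring.Sum +-*-semiring
  using (sum; sum-remove; sum-cong-≗; ∑-distrib-+; *-distribˡ-sum)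

sum-const : ∀ n c → sum {n} (λ _ → c) ≡ n * c
sum-const zero    c = refl
sum-const (suc n) c = cong (c +_) (sum-const n c)

sum-mono-≤ : ∀ {n} {f g : Vector ℕ n} → (∀ i → f i ≤ g i) → sum f ≤ sum g
sum-mono-≤ {zero}  f≤g = z≤n
sum-mono-≤ {suc n} f≤g = +-mono-≤ (f≤g zero) (sum-mono-≤ (f≤g ∘ suc))

≤∧sum-≡⇒≡ : ∀ {n} {f g : Vector ℕ n} → (∀ i → f i ≤ g i) → sum f ≡ sum g → ∀ i → f i ≡ g i
≤∧sum-≡⇒≡ {suc n} {f} {g} f≤g eq = λ { zero → head≡ ; (suc i) → ≤∧sum-≡⇒≡ (f≤g ∘ suc) tail≡ i }
  where
  head≡ : f zero ≡ g zero
  head≡ = ≤-antisym (f≤g zero) (+-cancelʳ-≤ _ _ _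
    (≤-trans (≤-reflexive (sym eq)) (+-monoʳ-≤ (f zero) (sum-mono-≤ (f≤g ∘ suc)))))
  tail≡ : sum (f ∘ suc) ≡ sum (g ∘ suc)
  tail≡ = +-cancelˡ-≡ (f zero) _ _ (trans eq (cong (_+ sum (g ∘ suc)) (sym head≡)))

sum-pos⇒∃-pos : ∀ {n} {f : Vector ℕ n} → 0 < sum f → ∃[ i ] 0 < f i
sum-pos⇒∃-pos {suc n} {f} pos with f zero in f0≡
... | suc _ = zero , subst (0 <_) (sym f0≡) z<s
... | zero with sum-pos⇒∃-pos {f = f ∘ suc} pos
...   | i , fi>0 = suc i , fi>0

removeAt-punchOut : ∀ {n} (f : Vector ℕ (suc n)) {a b} (a≢b : a ≢ b) → removeAt f a (punchOut a≢b) ≡ f b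
removeAt-punchOut f a≢b = cong f (punchIn-punchOut a≢b)

≤-sum : ∀ {n} (f : Vector ℕ n) a → f a ≤ sum f
≤-sum {suc n} f a = subst (f a ≤_) (sym (sum-remove f)) (m≤m+n (f a) _)

sum-support-≡ : ∀ {n} (f : Vector ℕ n) a → (∀ i → i ≢ a → f i ≡ 0) → sum f ≡ f a
sum-support-≡ {suc n} f a zero-off-a = begin
  sum f                     ≡⟨ sum-remove f ⟩
  f a + sum (removeAt f a)  ≡⟨ cong (f a +_) (sum-cong-≗ (λ j → zero-off-a _ (punchInᵢ≢i a j))) ⟩
  f a + sum {n} (λ _ → 0)   ≡⟨ cong (f a +_) (trans (sum-const n 0) (ℕ.*-zeroʳ n)) ⟩
  f a + 0                   ≡⟨ ℕ.+-identityʳ (f a) ⟩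
  f a                       ∎
  where open ≡-Reasoning

<-sum⇒∃-pos-≢ : ∀ {n} (f : Vector ℕ n) a → f a < sum f → ∃[ c ] c ≢ a × 0 < f c
<-sum⇒∃-pos-≢ {suc n} f a fa<sum with sum-pos⇒∃-pos {f = removeAt f a} rest-pos
  where
  rest-pos : 0 < sum (removeAt f a)
  rest-pos = +-cancelˡ-< (f a) _ _ (subst₂ _<_ (sym (ℕ.+-identityʳ (f a))) (sum-remove f) fa<sum)
... | j , pos = punchIn a j , punchInᵢ≢i a j , pos

+-≤-sum : ∀ {n} (f : Vector ℕ n) {a b} → a ≢ b → f a + f b ≤ sum f
+-≤-sum {suc n} f {a} {b} a≢b = subst (f a + f b ≤_) (sym (sum-remove f))
  (+-monoʳ-≤ (f a) (subst (_≤ sum (removeAt f a)) (removeAt-punchOut f a≢b) (≤-sum (removeAt f a) (punchOut a≢b))))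

+-+-≤-sum : ∀ {n} (f : Vector ℕ n) {a b c} → a ≢ b → a ≢ c → b ≢ c → f a + (f b + f c) ≤ sum f
+-+-≤-sum {suc n} f {a} {b} {c} a≢b a≢c b≢c = subst (f a + (f b + f c) ≤_) (sym (sum-remove f))
  (+-monoʳ-≤ (f a) (subst₂ (λ x y → x + y ≤ sum (removeAt f a))
    (removeAt-punchOut f a≢b) (removeAt-punchOut f a≢c)
    (+-≤-sum (removeAt f a) (b≢c ∘ punchOut-injective a≢b a≢c))))

+-<-sum⇒∃-pos-≢₂ : ∀ {n} (f : Vector ℕ n) {a b} → a ≢ b → f a + f b < sum f → ∃[ c ] c ≢ a × c ≢ b × 0 < f c
+-<-sum⇒∃-pos-≢₂ {suc n} f {a} {b} a≢b fa+fb<sum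
  with <-sum⇒∃-pos-≢ (removeAt f a) (punchOut a≢b) fb<rest
  where
  fb<rest : removeAt f a (punchOut a≢b) < sum (removeAt f a)
  fb<rest = +-cancelˡ-< (f a) _ _
    (subst₂ (λ x y → f a + x < y) (sym (removeAt-punchOut f a≢b)) (sum-remove f) fa+fb<sum)
... | j , j≢b , pos = punchIn a j , punchInᵢ≢i a j , j≢b ∘ punchIn≡b , pos
  where
  punchIn≡b : punchIn a j ≡ b → j ≡ punchOut a≢b
  punchIn≡b eq = punchIn-injective a j _ (trans eq (sym (punchIn-punchOut a≢b)))

∃-≢ : ∀ {n} → 2 ≤ n → (a : Fin n) → ∃[ c ] c ≢ a
∃-≢ (s≤s (s≤s _)) a = punchIn a zero , punchInᵢ≢i a zero

∃-≢₂ : ∀ {n} → 3 ≤ n → {a b : Fin n} → a ≢ b → ∃[ c ] c ≢ a × c ≢ b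
∃-≢₂ (s≤s (s≤s (s≤s _))) {a} {b} a≢b = punchIn a c , punchInᵢ≢i a c , c≢b
  where
  c : Fin _
  c = punchIn (punchOut a≢b) zero
  c≢b : punchIn a c ≢ b
  c≢b eq = punchInᵢ≢i (punchOut a≢b) zero (punchIn-injective a c _ (trans eq (sym (punchIn-punchOut a≢b))))

sum-map-tabulate : ∀ {A : Set} {n} (f : A → ℕ) (g : Fin n → A) → List.sum (map f (tabulate g)) ≡ sum (f ∘ g)
sum-map-tabulate {n = zero}  f g = refl
sum-map-tabulate {n = suc n} f g = cong (f (g zero) +_) (sum-map-tabulate f (g ∘ suc))

sum-map-const : ∀ {A : Set} (xs : List A) c → List.sum (map (λ _ → c) xs) ≡ length xs * c
sum-map-const []       c = refl
sum-map-const (x ∷ xs) c = cong (c +_) (sum-map-const xs c)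

∑-sum-map-comm : ∀ {A : Set} {n} (g : Fin n → A → ℕ) (xs : List A) →
                 sum (λ i → List.sum (map (g i) xs)) ≡ List.sum (map (λ x → sum (λ i → g i x)) xs)
∑-sum-map-comm {n = n} g []       = trans (sum-const n 0) (ℕ.*-zeroʳ n)
∑-sum-map-comm         g (x ∷ xs) =
  trans (∑-distrib-+ (λ i → g i x) _) (cong (sum (λ i → g i x) +_) (∑-sum-map-comm g xs))

sum-map-*ʳ : ∀ {A : Set} (f : A → ℕ) c (xs : List A) → List.sum (map (λ x → f x * c) xs) ≡ List.sum (map f xs) * c
sum-map-*ʳ f c []       = refl
sum-map-*ʳ f c (x ∷ xs) = trans (cong (f x * c +_) (sum-map-*ʳ f c xs)) (sym (ℕ.*-distribʳ-+ c (f x) _))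

χ : {A : Set} → Dec A → ℕ
χ (yes _) = 1
χ (no _)  = 0

χ-yes : {A : Set} (A? : Dec A) → A → χ A? ≡ 1
χ-yes (yes _) _ = refl
χ-yes (no ¬a) a = ⊥-elim (¬a a)

χ-no : {A : Set} (A? : Dec A) → ¬ A → χ A? ≡ 0
χ-no (yes a) ¬a = ⊥-elim (¬a a)
χ-no (no _)  _  = refl

_⇔-dec_ : {A B : Set} → Dec A → Dec B → Dec (A ⇔ B)
A? ⇔-dec B? = map′ (λ (to , from) → mk⇔ to from) (λ A⇔B → Equivalence.to A⇔B , Equivalence.from A⇔B)
  ((A? →-dec B?) ×-dec (B? →-dec A?))

At⇒∈ : ∀ {A : Set} {xs : List A} {i x} → xs At i ≔ x → x ∈ xs
At⇒∈ at0      = here refl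
At⇒∈ (atS xs) = there (At⇒∈ xs)

∈⇒At : ∀ {A : Set} {xs : List A} {x} → x ∈ xs → ∃[ i ] xs At i ≔ x
∈⇒At (here refl) = 0 , at0
∈⇒At (there x∈xs) = let i , at = ∈⇒At x∈xs in suc i , atS at

module _ {A : Set} {ℓ} {_≈_ : Rel A ℓ} where

  allPairs-At : Symmetric _≈_ → ∀ {xs i j x y} → AllPairs (λ x y → ¬ x ≈ y) xs →
                xs At i ≔ x → xs At j ≔ y → x ≈ y → i ≡ j
  allPairs-At ≈-sym _            at0      at0      _   = refl
  allPairs-At ≈-sym (x≉ ∷ _)     at0      (atS b)  x≈y = ⊥-elim (All.lookup x≉ (At⇒∈ b) x≈y)
  allPairs-At ≈-sym (x≉ ∷ _)     (atS a)  at0      x≈y = ⊥-elim (All.lookup x≉ (At⇒∈ a) (≈-sym x≈y))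
  allPairs-At ≈-sym (_ ∷ unique) (atS a)  (atS b)  x≈y = cong suc (allPairs-At ≈-sym unique a b x≈y)

module _ {A : Set} {Q : A → Set} (Q? : ∀ x → Dec (Q x)) where

  sum-χ-none : ∀ xs → (∀ {j y} → xs At j ≔ y → ¬ Q y) → List.sum (map (χ ∘ Q?) xs) ≡ 0
  sum-χ-none []       _    = refl
  sum-χ-none (x ∷ xs) none = cong₂ _+_ (χ-no (Q? x) (none at0)) (sum-χ-none xs (none ∘ atS))

  sum-χ-unique : ∀ xs → Any Q xs → (∀ {i j x y} → xs At i ≔ x → xs At j ≔ y → Q x → Q y → i ≡ j) →
                 List.sum (map (χ ∘ Q?) xs) ≡ 1
  sum-χ-unique (x ∷ xs) (here qx) unique =
    cong₂ _+_ (χ-yes (Q? x) qx) (sum-χ-none xs (λ at qy → ℕ.0≢1+n (unique at0 (atS at) qx qy)))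
  sum-χ-unique (x ∷ xs) (there any) unique =
    cong₂ _+_ (χ-no (Q? x) ¬qx) (sum-χ-unique xs any (λ a b qx qy → ℕ.suc-injective (unique (atS a) (atS b) qx qy)))
    where
    ¬qx : ¬ Q x
    ¬qx qx with find any
    ... | y , y∈xs , qy with ∈⇒At y∈xs
    ...   | j , at with unique at0 (atS at) qx qy
    ...     | ()

module _ {n : ℕ} where

  Endpoint : Fin n → Fin n × Fin n → Set
  Endpoint v p = proj₁ p ≡ v ⊎ proj₂ p ≡ v

  hits≡χ+χ : ∀ (v a b : Fin n) → hits v (a , b) ≡ χ (a ≟ v) + χ (b ≟ v)
  hits≡χ+χ v a b with a ≟ v | b ≟ v
  ... | yes _ | yes _ = refl
  ... | yes _ | no _  = refl
  ... | no _  | yes _ = refl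
  ... | no _  | no _  = refl

  sum-χ-≟ : ∀ (a : Fin n) → sum (λ v → χ (a ≟ v)) ≡ 1
  sum-χ-≟ a = trans (sum-support-≡ (λ v → χ (a ≟ v)) a (λ v v≢a → χ-no (a ≟ v) (v≢a ∘ sym)))
                    (χ-yes (a ≟ a) refl)

  sum-hits : ∀ (p : Fin n × Fin n) → sum (λ v → hits v p) ≡ 2
  sum-hits (a , b) = begin
    sum (λ v → hits v (a , b))                    ≡⟨ sum-cong-≗ (λ v → hits≡χ+χ v a b) ⟩
    sum (λ v → χ (a ≟ v) + χ (b ≟ v))             ≡⟨ ∑-distrib-+ (λ v → χ (a ≟ v)) _ ⟩
    sum (λ v → χ (a ≟ v)) + sum (λ v → χ (b ≟ v)) ≡⟨ cong₂ _+_ (sum-χ-≟ a) (sum-χ-≟ b) ⟩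
    2                                             ∎
    where open ≡-Reasoning

  handshake : ∀ (es : List (Fin n × Fin n)) → sum (degIn es) ≡ length es * 2
  handshake es = begin
    sum (λ v → List.sum (map (hits v) es))   ≡⟨ ∑-sum-map-comm hits es ⟩
    List.sum (map (λ p → sum (λ v → hits v p)) es) ≡⟨ cong List.sum (map-cong sum-hits es) ⟩
    List.sum (map (λ _ → 2) es)                ≡⟨ sum-map-const es 2 ⟩
    length es * 2                              ∎
    where open ≡-Reasoning

  hits-pos⇒endpoint : ∀ {v} p → 0 < hits v p → Endpoint v p
  hits-pos⇒endpoint {v} (a , b) pos with a ≟ v | b ≟ v
  ... | yes a≡v | _       = inj₁ a≡v
  ... | no _    | yes b≡v = inj₂ b≡v
  ... | no _    | no _    = ⊥-elim (<-irrefl refl pos)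

  endpoint⇒hits≡1 : ∀ {v} p → proj₁ p ≢ proj₂ p → Endpoint v p → hits v p ≡ 1
  endpoint⇒hits≡1 {v} (a , b) a≢b v∈p with a ≟ v | b ≟ v
  ... | yes a≡v | yes b≡v = ⊥-elim (a≢b (trans a≡v (sym b≡v)))
  ... | yes _   | no _    = refl
  ... | no _    | yes _   = refl
  ... | no a≢v  | no b≢v  = ⊥-elim ([ a≢v , b≢v ]′ v∈p)

  ¬endpoint⇒hits≡0 : ∀ {v} p → ¬ Endpoint v p → hits v p ≡ 0
  ¬endpoint⇒hits≡0 {v} (a , b) v∉p with a ≟ v | b ≟ v
  ... | yes a≡v | _       = ⊥-elim (v∉p (inj₁ a≡v))
  ... | no _    | yes b≡v = ⊥-elim (v∉p (inj₂ b≡v))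
  ... | no _    | no _    = refl

  sameEnds-sym : {p q : Fin n × Fin n} → SameEnds p q → SameEnds q p
  sameEnds-sym (inj₁ (refl , refl)) = inj₁ (refl , refl)
  sameEnds-sym (inj₂ (refl , refl)) = inj₂ (refl , refl)

  sameEnds-trans : {p q r : Fin n × Fin n} → SameEnds p q → SameEnds q r → SameEnds p r
  sameEnds-trans (inj₁ (refl , refl)) q~r                  = q~r
  sameEnds-trans (inj₂ (refl , refl)) (inj₁ (refl , refl)) = inj₂ (refl , refl)
  sameEnds-trans (inj₂ (refl , refl)) (inj₂ (refl , refl)) = inj₁ (refl , refl)

  sameEnds-endpoint : {p q : Fin n × Fin n} {v : Fin n} → SameEnds p q → Endpoint v p → Endpoint v q
  sameEnds-endpoint (inj₁ (refl , refl)) v∈p = v∈p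
  sameEnds-endpoint (inj₂ (refl , refl)) v∈p = swap v∈p

  sameEnds? : (p q : Fin n × Fin n) → Dec (SameEnds p q)
  sameEnds? (a , b) (c , d) = ((a ≟ c) ×-dec (b ≟ d)) ⊎-dec ((a ≟ d) ×-dec (b ≟ c))

  sameEnds-refl : ∀ {p : Fin n × Fin n} → SameEnds p p
  sameEnds-refl = inj₁ (refl , refl)

  sameEnds-swap : ∀ {a b : Fin n} → SameEnds (a , b) (b , a)
  sameEnds-swap = inj₂ (refl , refl)

  module _ {p : Fin n × Fin n} {a b : Fin n} where

    sameEnds⇒endpointˡ : SameEnds p (a , b) → Endpoint a p
    sameEnds⇒endpointˡ p~ab = sameEnds-endpoint (sameEnds-sym p~ab) (inj₁ refl)

    sameEnds⇒endpointʳ : SameEnds p (a , b) → Endpoint b p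
    sameEnds⇒endpointʳ p~ab = sameEnds-endpoint (sameEnds-sym p~ab) (inj₂ refl)

  other-end : ∀ (p : Fin n × Fin n) {u} → Endpoint u p → ∃[ w ] SameEnds p (u , w)
  other-end (a , b) (inj₁ refl) = b , inj₁ (refl , refl)
  other-end (a , b) (inj₂ refl) = a , inj₂ (refl , refl)

  other-end-unique : ∀ {p : Fin n × Fin n} {u w x} → SameEnds p (u , w) → SameEnds p (u , x) → w ≡ x
  other-end-unique (inj₁ (refl , refl)) (inj₁ (refl , refl)) = refl
  other-end-unique (inj₁ (refl , refl)) (inj₂ (refl , refl)) = refl
  other-end-unique (inj₂ (refl , refl)) (inj₁ (refl , refl)) = refl
  other-end-unique (inj₂ (refl , refl)) (inj₂ (refl , refl)) = refl

module _ {n m : ℕ} (G : SimpleGraph n m) where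

  Incident : Fin n → Fin m → Set
  Incident v e = Endpoint v (ends G e)

  deg-≡-∑ : ∀ v → deg G v ≡ sum (λ e → hits v (ends G e))
  deg-≡-∑ v = trans (cong List.sum (sym (map-∘ (allFin m)))) (sum-map-tabulate (hits v ∘ ends G) id)

  sum-deg : sum (deg G) ≡ m * 2
  sum-deg = trans (handshake (edgeList G)) (cong (_* 2) (trans (length-map (ends G) (allFin m)) (length-tabulate {n = m} id)))

  2-regular⇒m≡n : (∀ v → deg G v ≡ 2) → m ≡ n
  2-regular⇒m≡n deg≡2 = ℕ.*-cancelʳ-≡ m n 2 (begin
    m * 2               ≡⟨ sum-deg ⟨
    sum (deg G)         ≡⟨ sum-cong-≗ deg≡2 ⟩
    sum {n} (λ _ → 2)   ≡⟨ sum-const n 2 ⟩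
    n * 2               ∎)
    where open ≡-Reasoning

  incident⇒hits≡1 : ∀ {v e} → Incident v e → hits v (ends G e) ≡ 1
  incident⇒hits≡1 {e = e} = endpoint⇒hits≡1 (ends G e) (loopless G e)

  hits-pos⇒incident : ∀ {v e} → 0 < hits v (ends G e) → Incident v e
  hits-pos⇒incident {e = e} = hits-pos⇒endpoint (ends G e)

  sameEnds-injective : ∀ {e f p} → SameEnds (ends G e) p → SameEnds (ends G f) p → e ≡ f
  sameEnds-injective e~p f~p = noMulti G _ _ (sameEnds-trans e~p (sameEnds-sym f~p))

  Adj-sym : ∀ {u w} → Adj G u w → Adj G w u
  Adj-sym (e , e~uw) = e , sameEnds-trans e~uw sameEnds-swap

  sameEnds⇒≢ : ∀ {e a b} → SameEnds (ends G e) (a , b) → a ≢ b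
  sameEnds⇒≢ {e} (inj₁ (refl , refl)) = loopless G e
  sameEnds⇒≢ {e} (inj₂ (refl , refl)) = loopless G e ∘ sym

  module _ {v : Fin n} where

    0<deg⇒incident : 0 < deg G v → ∃[ e ] Incident v e
    0<deg⇒incident 0<deg with sum-pos⇒∃-pos (subst (0 <_) (deg-≡-∑ v) 0<deg)
    ... | e , pos = e , hits-pos⇒incident pos

    private
      h : Fin m → ℕ
      h e = hits v (ends G e)

    incident⇒2≤deg : ∀ {a b} → a ≢ b → Incident v a → Incident v b → 2 ≤ deg G v
    incident⇒2≤deg a≢b va vb =
      subst₂ _≤_ (cong₂ _+_ (incident⇒hits≡1 va) (incident⇒hits≡1 vb)) (sym (deg-≡-∑ v)) (+-≤-sum h a≢b)

    deg≤1⇒incident-unique : ∀ {a b} → deg G v ≤ 1 → Incident v a → Incident v b → a ≡ b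
    deg≤1⇒incident-unique {a} {b} deg≤1 va vb with a ≟ b
    ... | yes a≡b = a≡b
    ... | no a≢b  = ⊥-elim (<-irrefl refl (≤-trans (incident⇒2≤deg a≢b va vb) deg≤1))

    deg≡2⇒incident-either : ∀ {a b c} → deg G v ≡ 2 → a ≢ b → Incident v a → Incident v b → Incident v c →
                            c ≡ a ⊎ c ≡ b
    deg≡2⇒incident-either {a} {b} {c} deg≡2 a≢b va vb vc with c ≟ a | c ≟ b
    ... | yes c≡a | _       = inj₁ c≡a
    ... | no _    | yes c≡b = inj₂ c≡b
    ... | no c≢a  | no c≢b  = ⊥-elim (<-irrefl refl (subst₂ _≤_
      (cong₂ _+_ (incident⇒hits≡1 va) (cong₂ _+_ (incident⇒hits≡1 vb) (incident⇒hits≡1 vc)))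
      (trans (sym (deg-≡-∑ v)) deg≡2)
      (+-+-≤-sum h a≢b (c≢a ∘ sym) (c≢b ∘ sym))))

    deg≡2⇒other-incident : ∀ {a} → deg G v ≡ 2 → Incident v a → ∃[ b ] b ≢ a × Incident v b
    deg≡2⇒other-incident {a} deg≡2 va
      with <-sum⇒∃-pos-≢ h a (subst₂ _<_ (sym (incident⇒hits≡1 va)) (trans (sym deg≡2) (deg-≡-∑ v)) (s≤s (s≤s z≤n)))
    ... | b , b≢a , pos = b , b≢a , hits-pos⇒incident pos

    3≤deg⇒third-incident : ∀ {a b} → 3 ≤ deg G v → a ≢ b → Incident v a → Incident v b →
                           ∃[ c ] c ≢ a × c ≢ b × Incident v c
    3≤deg⇒third-incident {a} {b} 3≤deg a≢b va vb
      with +-<-sum⇒∃-pos-≢₂ h a≢b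
             (subst₂ _<_ (sym (cong₂ _+_ (incident⇒hits≡1 va) (incident⇒hits≡1 vb))) (deg-≡-∑ v) 3≤deg)
    ... | c , c≢a , c≢b , pos = c , c≢a , c≢b , hits-pos⇒incident pos

module _ {n m : ℕ} {G : SimpleGraph n m} {P : Fin n → Set} where

  walk-head : ∀ {u v} → WalkIn G P u v → P u
  walk-head (here pu)     = pu
  walk-head (step pu _ _) = pu

  first-step : ∀ {u v} → WalkIn G P u v → u ≢ v → ∃[ w ] P w × Adj G u w
  first-step (here _)       u≢u = ⊥-elim (u≢u refl)
  first-step (step _ uw wv) _   = _ , walk-head wv , uw

  walk-closed : {S : Fin n → Set} → (∀ {u w} → S u → P w → Adj G u w → S w) →
                ∀ {u v} → S u → WalkIn G P u v → S v
  walk-closed closed su (here _)      = su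
  walk-closed closed su (step _ uw wv) = walk-closed closed (closed su (walk-head wv) uw) wv

2≤deg : ∀ {n m} (G : SimpleGraph n m) → TwoConnected G → ∀ u → 2 ≤ deg G u
2≤deg G (3≤n , conn , conn₋) u with 2 ≤? deg G u
... | yes 2≤deg = 2≤deg
... | no 2≰deg with ∃-≢ (≤-trans (ℕ.n≤1+n 2) 3≤n) u
... | c , c≢u with first-step (conn u c) (c≢u ∘ sym)
... | x , _ , a , a~ux with ∃-≢₂ 3≤n (sameEnds⇒≢ G a~ux)
... | d , d≢u , d≢x with first-step (conn₋ x u d (sameEnds⇒≢ G a~ux) d≢x) (d≢u ∘ sym)
... | y , y≢x , b , b~uy =
  ⊥-elim (y≢x (sym (other-end-unique (subst (λ e → SameEnds (ends G e) _) a≡b a~ux) b~uy)))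
  where
  a≡b : a ≡ b
  a≡b = deg≤1⇒incident-unique G (ℕ.≤-pred (ℕ.≰⇒> 2≰deg))
                                (sameEnds⇒endpointˡ a~ux) (sameEnds⇒endpointˡ b~uy)

¬2<deg⇒deg≡2 : ∀ {n m} (G : SimpleGraph n m) → TwoConnected G → ∀ {v} → ¬ 2 < deg G v → deg G v ≡ 2
¬2<deg⇒deg≡2 G 2conn 2≮deg = ≤-antisym (≮⇒≥ 2≮deg) (2≤deg G 2conn _)

data Position {k : ℕ} : Fin (suc (suc k)) → Set where
  start : Position zero
  end   : Position (fromℕ (suc k))
  inner : (t : Fin k) → Position (suc (inject₁ t))

position : ∀ {k} (r : Fin (suc (suc k))) → Position r
position zero = start
position (suc r) with view r
... | ‵fromℕ     = end
... | ‵inject₁ t = inner t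

inject₁≡0⇒≡0 : ∀ {k} {t : Fin (suc k)} → inject₁ t ≡ zero → t ≡ zero
inject₁≡0⇒≡0 {t = zero} _ = refl

inject₁≡suc⇒suc≢inject₁ : ∀ {k} {i j : Fin k} → inject₁ i ≡ suc j → suc i ≢ inject₁ j
inject₁≡suc⇒suc≢inject₁ {i = i} {j} i≡j+1 i+1≡j = ℕ.<-asym j<i i<j
  where
  j<i : toℕ j < toℕ i
  j<i = ℕ.≤-reflexive (trans (cong toℕ (sym i≡j+1)) (toℕ-inject₁ i))
  i<j : toℕ i < toℕ j
  i<j = ℕ.≤-reflexive (trans (cong toℕ i+1≡j) (toℕ-inject₁ j))

inject₁≢suc : ∀ {k} (t : Fin k) → inject₁ t ≢ suc t
inject₁≢suc t eq = ℕ.1+n≢n (sym (trans (sym (toℕ-inject₁ t)) (cong toℕ eq)))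

opposite-inject₁ : ∀ {k} (j : Fin k) → opposite (inject₁ j) ≡ suc (opposite j)
opposite-inject₁ zero    = refl
opposite-inject₁ (suc j) = cong inject₁ (opposite-inject₁ j)

opposite-fromℕ : ∀ k → opposite (fromℕ k) ≡ zero
opposite-fromℕ zero    = refl
opposite-fromℕ (suc k) = cong inject₁ (opposite-fromℕ k)

record BarePath {n m : ℕ} (G : SimpleGraph n m) : Set where
  field
    k        : ℕ
    vs       : Fin (suc (suc k)) → Fin n
    distinct : Injective _≡_ _≡_ vs
    adjacent : ∀ (j : Fin (suc k)) → Adj G (vs (inject₁ j)) (vs (suc j))
    innerDeg : ∀ (j : Fin k) → deg G (vs (suc (inject₁ j))) ≡ 2
open BarePath public

module _ {n m : ℕ} {G : SimpleGraph n m} (P : BarePath G) where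

  InBarePath : Fin m → Set
  InBarePath e = ∃[ j ] SameEnds (ends G e) (vs P (inject₁ j) , vs P (suc j))

  edge : Fin (suc (k P)) → Fin m
  edge j = proj₁ (adjacent P j)

  edge-spans : ∀ j → SameEnds (ends G (edge j)) (vs P (inject₁ j) , vs P (suc j))
  edge-spans j = proj₂ (adjacent P j)

  edge-inBarePath : ∀ j → InBarePath (edge j)
  edge-inBarePath j = j , edge-spans j

  spans⇒≡edge : ∀ {e j} → SameEnds (ends G e) (vs P (inject₁ j) , vs P (suc j)) → e ≡ edge j
  spans⇒≡edge {j = j} e-spans = sameEnds-injective G e-spans (edge-spans j)

  edge-injective : Injective _≡_ _≡_ edge
  edge-injective {i} {j} eq
    with sameEnds-trans (sameEnds-sym (edge-spans i)) (subst (λ e → SameEnds (ends G e) _) (sym eq) (edge-spans j))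
  ... | inj₁ (eq₁ , _)     = inject₁-injective (distinct P eq₁)
  ... | inj₂ (eq₁ , eq₂) = ⊥-elim (inject₁≡suc⇒suc≢inject₁ (distinct P eq₁) (distinct P eq₂))

  inBarePath-endpoint : ∀ {v e} → InBarePath e → Incident G v e → ∃[ r ] vs P r ≡ v
  inBarePath-endpoint (j , e-spans) v∈e with sameEnds-endpoint e-spans v∈e
  ... | inj₁ eq = inject₁ j , eq
  ... | inj₂ eq = suc j , eq

  incident-inner : ∀ t {f} → Incident G (vs P (suc (inject₁ t))) f → f ≡ edge (inject₁ t) ⊎ f ≡ edge (suc t)
  incident-inner t = deg≡2⇒incident-either G (innerDeg P t) (inject₁≢suc t ∘ edge-injective)
    (sameEnds⇒endpointʳ (edge-spans (inject₁ t))) (sameEnds⇒endpointˡ (edge-spans (suc t)))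

  incident-start⇒≡0 : ∀ {j} → Incident G (vs P zero) (edge j) → j ≡ zero
  incident-start⇒≡0 {j} v₀∈e with sameEnds-endpoint (edge-spans j) v₀∈e
  ... | inj₁ eq = inject₁≡0⇒≡0 (distinct P eq)
  ... | inj₂ eq with distinct P eq
  ...   | ()

  incident-end⇒≡last : ∀ {j} → Incident G (vs P (fromℕ (suc (k P)))) (edge j) → j ≡ fromℕ (k P)
  incident-end⇒≡last {j} vₗ∈e with sameEnds-endpoint (edge-spans j) vₗ∈e
  ... | inj₁ eq = ⊥-elim (fromℕ≢inject₁ (sym (distinct P eq)))
  ... | inj₂ eq = suc-injective (distinct P eq)

module _ {n m : ℕ} {G : SimpleGraph n m} where

  reverse : BarePath G → BarePath G
  reverse P = record
    { k        = k P
    ; vs       = vs P ∘ opposite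
    ; distinct = λ eq → trans (sym (opposite-involutive _))
                               (trans (cong opposite (distinct P eq)) (opposite-involutive _))
    ; adjacent = λ j → subst (λ r → Adj G (vs P r) (vs P (inject₁ (opposite j)))) (sym (opposite-inject₁ j))
                             (Adj-sym G (adjacent P (opposite j)))
    ; innerDeg = λ j → subst (λ r → deg G (vs P (inject₁ r)) ≡ 2) (sym (opposite-inject₁ j))
                             (innerDeg P (opposite j))
    }

  reverse-end : ∀ P → vs (reverse P) (fromℕ (suc (k P))) ≡ vs P zero
  reverse-end P = cong (vs P) (opposite-fromℕ (suc (k P)))

  reverse-inBarePath : ∀ P {e} → InBarePath P e → InBarePath (reverse P) e
  reverse-inBarePath P {e} (j , e-spans) =
    opposite j , subst (SameEnds (ends G e)) ends≡ (sameEnds-trans e-spans sameEnds-swap)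
    where
    ends≡ : (vs P (suc j) , vs P (inject₁ j)) ≡
            (vs P (opposite (inject₁ (opposite j))) , vs P (inject₁ (opposite (opposite j))))
    ends≡ = cong₂ _,_ (cong (vs P) (sym (trans (opposite-inject₁ (opposite j)) (cong suc (opposite-involutive j)))))
                      (cong (vs P ∘ inject₁) (sym (opposite-involutive j)))

  prepend : (P : BarePath G) (x : Fin n) → (∀ r → vs P r ≢ x) → Adj G x (vs P zero) →
            deg G (vs P zero) ≡ 2 → BarePath G
  prepend P x x∉P x~v₀ deg-v₀ = record
    { k        = suc (k P)
    ; vs       = vs⁺
    ; distinct = distinct⁺
    ; adjacent = λ { zero → x~v₀ ; (suc j) → adjacent P j }
    ; innerDeg = λ { zero → deg-v₀ ; (suc j) → innerDeg P j }
    }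
    where
    vs⁺ : Fin (suc (suc (suc (k P)))) → Fin n
    vs⁺ zero    = x
    vs⁺ (suc r) = vs P r
    distinct⁺ : Injective _≡_ _≡_ vs⁺
    distinct⁺ {zero}  {zero}  _  = refl
    distinct⁺ {zero}  {suc j} eq = ⊥-elim (x∉P j (sym eq))
    distinct⁺ {suc i} {zero}  eq = ⊥-elim (x∉P i eq)
    distinct⁺ {suc i} {suc j} eq = cong suc (distinct P eq)

  singleEdge : Fin m → BarePath G
  singleEdge e = record
    { k        = 0
    ; vs       = λ { zero → proj₁ (ends G e) ; (suc zero) → proj₂ (ends G e) }
    ; distinct = λ { {zero} {zero} _ → refl ; {zero} {suc zero} eq → ⊥-elim (loopless G e eq)
                   ; {suc zero} {zero} eq → ⊥-elim (loopless G e (sym eq)) ; {suc zero} {suc zero} _ → refl }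
    ; adjacent = λ { zero → e , sameEnds-refl }
    ; innerDeg = λ ()
    }

  singleEdge-inBarePath : ∀ e → InBarePath (singleEdge e) e
  singleEdge-inBarePath e = zero , sameEnds-refl

bare : ∀ {n m} {G : SimpleGraph n m} → ChainPath G → BarePath G
bare P = record { k = k P ; vs = vs P ; distinct = distinct P ; adjacent = adjacent P ; innerDeg = innerDeg P }

-- If the far end z had a third edge, deleting z would cut its other end off from the rest of the
-- path, so the path together with c is a 2-regular component of G, hence all of G.
module ClosedBarePath {n m : ℕ} {G : SimpleGraph n m} (2conn : TwoConnected G) (P : BarePath G)
  (deg-v₀ : deg G (vs P zero) ≡ 2) {c : Fin m}
  (c-closes : SameEnds (ends G c) (vs P zero , vs P (fromℕ (suc (k P)))))
  (c∉P : ∀ j → c ≢ edge P j) where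

  private
    L : Fin (suc (suc (k P)))
    L = fromℕ (suc (k P))

    v₀ z : Fin n
    v₀ = vs P zero
    z  = vs P L

    On : Fin n → Set
    On y = ∃[ r ] vs P r ≡ y

    CycleEdge : Fin m → Set
    CycleEdge f = f ≡ c ⊎ ∃[ j ] f ≡ edge P j

    cycleEdge-endpoint : ∀ {f w} → CycleEdge f → Incident G w f → On w
    cycleEdge-endpoint (inj₁ refl) w∈c with sameEnds-endpoint c-closes w∈c
    ... | inj₁ eq = zero , eq
    ... | inj₂ eq = L , eq
    cycleEdge-endpoint (inj₂ (j , refl)) w∈e = inBarePath-endpoint P (edge-inBarePath P j) w∈e

    incident-off-z : ∀ {s f} → s ≢ L → Incident G (vs P s) f → CycleEdge f
    incident-off-z {s} s≢L vₛ∈f with position s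
    ... | end     = ⊥-elim (s≢L refl)
    ... | inner t with incident-inner P t vₛ∈f
    ...   | inj₁ eq = inj₂ (_ , eq)
    ...   | inj₂ eq = inj₂ (_ , eq)
    incident-off-z {s} s≢L vₛ∈f | start with deg≡2⇒incident-either G deg-v₀ (c∉P zero) (sameEnds⇒endpointˡ c-closes)
                       (sameEnds⇒endpointˡ (edge-spans P zero)) vₛ∈f
    ...   | inj₁ eq = inj₁ eq
    ...   | inj₂ eq = inj₂ (zero , eq)

    OffZ : Fin n → Set
    OffZ u = ∃[ s ] s ≢ L × vs P s ≡ u

    offZ-closed : ∀ {u w} → OffZ u → w ≢ z → Adj G u w → OffZ w
    offZ-closed (s , s≢L , refl) w≢z (f , f~uw)
      with cycleEdge-endpoint (incident-off-z s≢L (sameEnds⇒endpointˡ f~uw)) (sameEnds⇒endpointʳ f~uw)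
    ... | r , refl = r , (λ { refl → w≢z refl }) , refl

    incident-z : ∀ {f} → Incident G z f → f ≡ c ⊎ f ≡ edge P (fromℕ (k P))
    incident-z {f} z∈f with other-end (ends G f) z∈f
    ... | y , f~zy with walk-closed offZ-closed (zero , (λ ()) , refl) (proj₂ (proj₂ 2conn) z v₀ y v₀≢z y≢z)
      where
      v₀≢z : v₀ ≢ z
      v₀≢z eq with distinct P eq
      ... | ()
      y≢z : y ≢ z
      y≢z = sameEnds⇒≢ G f~zy ∘ sym
    ... | s , s≢L , refl with incident-off-z s≢L (sameEnds⇒endpointʳ f~zy)
    ...   | inj₁ eq       = inj₁ eq
    ...   | inj₂ (j , refl) = inj₂ (cong (edge P) (incident-end⇒≡last P z∈f))

    deg-z : deg G z ≡ 2
    deg-z with deg G z ℕ.≟ 2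
    ... | yes deg≡2 = deg≡2
    ... | no deg≢2 with 3≤deg⇒third-incident G (ℕ.≤∧≢⇒< (2≤deg G 2conn z) (deg≢2 ∘ sym))
                          (c∉P _) (sameEnds⇒endpointʳ c-closes) (sameEnds⇒endpointʳ (edge-spans P (fromℕ (k P))))
    ... | f , f≢c , f≢last , z∈f = ⊥-elim ([ f≢c , f≢last ]′ (incident-z z∈f))

    incident-cycle : ∀ {s f} → Incident G (vs P s) f → CycleEdge f
    incident-cycle {s} vₛ∈f with s ≟ L
    ... | no s≢L = incident-off-z s≢L vₛ∈f
    ... | yes refl with incident-z vₛ∈f
    ...   | inj₁ eq = inj₁ eq
    ...   | inj₂ eq = inj₂ (_ , eq)

    all-on : ∀ y → On y
    all-on y = walk-closed closed (zero , refl) (proj₁ (proj₂ 2conn) v₀ y)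
      where
      closed : ∀ {u w} → On u → ⊤ → Adj G u w → On w
      closed (r , refl) _ (f , f~uw) =
        cycleEdge-endpoint (incident-cycle (sameEnds⇒endpointˡ f~uw)) (sameEnds⇒endpointʳ f~uw)

  2-regular : ∀ v → deg G v ≡ 2
  2-regular v with all-on v
  ... | r , refl with position r
  ...   | start   = deg-v₀
  ...   | end     = deg-z
  ...   | inner t = innerDeg P t

line-⇔ : ∀ {k} (R : Fin (suc k) → Set) → (∀ t → R (inject₁ t) ⇔ R (suc t)) → ∀ i → R zero ⇔ R i
line-⇔ R link zero = ⇔.refl
line-⇔ {suc k} R link (suc i) = ⇔.trans (line-⇔ (R ∘ inject₁) (link ∘ inject₁) i) (link i)

module _ {n m : ℕ} {G : SimpleGraph n m} where

  chain-closed : (Q : ChainPath G) → ∀ {u g f} → deg G u ≡ 2 →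
                 InPath Q g → Incident G u g → Incident G u f → InPath Q f
  chain-closed Q deg≡2 g∈Q u∈g u∈f with inBarePath-endpoint (bare Q) g∈Q u∈g
  ... | r , refl with position r
  ...   | start   = ⊥-elim (<-irrefl (sym deg≡2) (startDeg Q))
  ...   | end     = ⊥-elim (<-irrefl (sym deg≡2) (endDeg Q))
  ...   | inner t with incident-inner (bare Q) t u∈f
  ...     | inj₁ refl = edge-inBarePath (bare Q) _
  ...     | inj₂ refl = edge-inBarePath (bare Q) _

  shared-edge⇒⊆ : (P Q : ChainPath G) → ∀ {e} → InPath P e → InPath Q e → ∀ {f} → InPath P f → InPath Q f
  shared-edge⇒⊆ P Q (i , e-spans) e∈Q (j , f-spans) =
    subst (InPath Q) (sym (spans⇒≡edge (bare P) f-spans))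
      (Equivalence.to (line-⇔ R link j) (Equivalence.from (line-⇔ R link i)
        (subst (InPath Q) (spans⇒≡edge (bare P) e-spans) e∈Q)))
    where
    R : Fin (suc (k P)) → Set
    R j = InPath Q (edge (bare P) j)
    link : ∀ t → R (inject₁ t) ⇔ R (suc t)
    link t = mk⇔ (λ r → chain-closed Q (innerDeg P t) r left right)
                 (λ r → chain-closed Q (innerDeg P t) r right left)
      where
      left : Incident G (vs P (suc (inject₁ t))) (edge (bare P) (inject₁ t))
      left = sameEnds⇒endpointʳ (edge-spans (bare P) (inject₁ t))
      right : Incident G (vs P (suc (inject₁ t))) (edge (bare P) (suc t))
      right = sameEnds⇒endpointˡ (edge-spans (bare P) (suc t))

  shared-edge⇒sameChain : (P Q : ChainPath G) → ∀ {e} → InPath P e → InPath Q e → SameChain P Q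
  shared-edge⇒sameChain P Q e∈P e∈Q f = mk⇔ (shared-edge⇒⊆ P Q e∈P e∈Q) (shared-edge⇒⊆ Q P e∈Q e∈P)

module _ {n m : ℕ} {G : SimpleGraph n m} (2conn : TwoConnected G) (m≢n : m ≢ n) where

  start-extensible : (P : BarePath G) → deg G (vs P zero) ≡ 2 → ∃[ x ] (∀ r → vs P r ≢ x) × Adj G x (vs P zero)
  start-extensible P deg≡2 with deg≡2⇒other-incident G deg≡2 (sameEnds⇒endpointˡ (edge-spans P zero))
  ... | c , c≢e₀ , v₀∈c with other-end (ends G c) v₀∈c
  ... | x , c~v₀x = x , x∉P , c , sameEnds-trans c~v₀x sameEnds-swap
    where
    c∉P : ∀ j → c ≢ edge P j
    c∉P j refl = c≢e₀ (cong (edge P) (incident-start⇒≡0 P v₀∈c))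
    x∉P : ∀ r → vs P r ≢ x
    x∉P r refl with position r
    ... | start   = sameEnds⇒≢ G c~v₀x refl
    ... | end     = m≢n (2-regular⇒m≡n G (ClosedBarePath.2-regular 2conn P deg≡2 c~v₀x c∉P))
    ... | inner t = [ c∉P _ , c∉P _ ]′ (incident-inner P t (sameEnds⇒endpointʳ c~v₀x))

  prepend-start : (P : BarePath G) → deg G (vs P zero) ≡ 2 → BarePath G
  prepend-start P deg≡2 = let x , x∉P , x~v₀ = start-extensible P deg≡2 in prepend P x x∉P x~v₀ deg≡2

  record StartExtension (P : BarePath G) : Set where
    field
      path       : BarePath G
      startDeg>2 : 2 < deg G (vs path zero)
      ⊇edges     : ∀ {e} → InBarePath P e → InBarePath path e
      sameEnd    : vs path (fromℕ (suc (k path))) ≡ vs P (fromℕ (suc (k P)))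
  open StartExtension

  -- A bare path has at most n vertices, so the fuel outlasts the prepending.
  extend-start     : ∀ fuel (P : BarePath G) → n ≤ suc (suc (k P)) + fuel → StartExtension P
  extend-prepended : ∀ fuel (P : BarePath G) → deg G (vs P zero) ≡ 2 → n ≤ suc (suc (k P)) + fuel → StartExtension P

  extend-start fuel P n≤ with 2 <? deg G (vs P zero)
  ... | yes 2<deg = record { path = P ; startDeg>2 = 2<deg ; ⊇edges = id ; sameEnd = refl }
  ... | no 2≮deg  = extend-prepended fuel P (¬2<deg⇒deg≡2 G 2conn 2≮deg) n≤

  extend-prepended zero P deg≡2 n≤ = ⊥-elim (ℕ.1+n≰n (≤-trans (injective⇒≤ (distinct (prepend-start P deg≡2)))
                                                             (subst (n ≤_) (ℕ.+-identityʳ _) n≤)))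
  extend-prepended (suc fuel) P deg≡2 n≤ = record
    { path       = path X
    ; startDeg>2 = startDeg>2 X
    ; ⊇edges     = λ { (j , e-spans) → ⊇edges X (suc j , e-spans) }
    ; sameEnd    = sameEnd X
    }
    where
    X : StartExtension (prepend-start P deg≡2)
    X = extend-start fuel (prepend-start P deg≡2) (subst (n ≤_) (+-suc _ fuel) n≤)

  extend-to-chain : (P : BarePath G) → ∃[ Q ] (∀ {e} → InBarePath P e → InPath Q e)
  extend-to-chain P = Q , ⊇edges X₂ ∘ reverse-inBarePath P₁ ∘ ⊇edges X₁
    where
    X₁ : StartExtension P
    X₁ = extend-start n P (m≤n+m n _)
    P₁ : BarePath G
    P₁ = path X₁
    X₂ : StartExtension (reverse P₁)
    X₂ = extend-start n (reverse P₁) (m≤n+m n _)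
    P₂ : BarePath G
    P₂ = path X₂
    Q : ChainPath G
    Q = record
      { k        = k P₂
      ; vs       = vs P₂
      ; distinct = distinct P₂
      ; adjacent = adjacent P₂
      ; innerDeg = innerDeg P₂
      ; startDeg = startDeg>2 X₂
      ; endDeg   = subst (λ v → 2 < deg G v) (sym (trans (sameEnd X₂) (reverse-end P₁))) (startDeg>2 X₁)
      }

  chainThrough : ∀ e → ∃[ Q ] InPath Q e
  chainThrough e = let Q , ⊇ = extend-to-chain (singleEdge e) in Q , ⊇ (singleEdge-inBarePath e)

module _ {n m : ℕ} {G : SimpleGraph n m} where

  inPath? : (P : ChainPath G) → ∀ e → Dec (InPath P e)
  inPath? P e = any? (λ j → sameEnds? (ends G e) _)

  sameChain? : B.Decidable (SameChain {G = G})
  sameChain? P Q = all? (λ e → inPath? P e ⇔-dec inPath? Q e)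

  sameChain-isEquivalence : IsEquivalence (SameChain {G = G})
  sameChain-isEquivalence = record
    { refl  = λ _ → ⇔.refl
    ; sym   = λ P~Q e → ⇔.sym (P~Q e)
    ; trans = λ P~Q Q~R e → ⇔.trans (P~Q e) (Q~R e)
    }

  chainDecSetoid : DecSetoid 0ℓ 0ℓ
  chainDecSetoid = record
    { Carrier          = ChainPath G
    ; _≈_              = SameChain
    ; isDecEquivalence = record { isEquivalence = sameChain-isEquivalence ; _≟_ = sameChain? }
    }

  internal⇒deg≡2 : ∀ (Q : ChainPath G) {v} → Internal Q v → deg G v ≡ 2
  internal⇒deg≡2 Q (t , refl) = innerDeg Q t

  incidence : ChainPath G → Fin n → Fin m → ℕ
  incidence P v e = χ (inPath? P e) * hits v (ends G e)

  module _ (P : ChainPath G) where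

    incidence≡0 : ∀ {v e} → (InPath P e → Incident G v e → ⊥) → incidence P v e ≡ 0
    incidence≡0 {e = e} ¬both with inPath? P e
    ... | no _    = refl
    ... | yes e∈P = trans (ℕ.+-identityʳ _) (ℕ.n≤0⇒n≡0 (ℕ.≮⇒≥ (¬both e∈P ∘ hits-pos⇒incident G)))

    sum-incidence-off : ∀ {v} → (∀ r → vs P r ≢ v) → sum (incidence P v) ≡ 0
    sum-incidence-off {v} v∉P =
      trans (sum-cong-≗ (λ e → incidence≡0 {e = e} (v∉e e))) (trans (sum-const m 0) (ℕ.*-zeroʳ m))
      where
      v∉e : ∀ e → InPath P e → Incident G v e → ⊥
      v∉e e e∈P v∈e = v∉P _ (proj₂ (inBarePath-endpoint (bare P) e∈P v∈e))

    sum-incidence-single : ∀ {v} a → Incident G v (edge (bare P) a) →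
                           (∀ {j} → Incident G v (edge (bare P) j) → j ≡ a) → sum (incidence P v) ≡ 1
    sum-incidence-single {v} a v∈a only-a = trans (sum-support-≡ (incidence P v) (edge (bare P) a) off-a)
      (cong₂ _*_ (χ-yes (inPath? P _) (edge-inBarePath (bare P) a)) (incident⇒hits≡1 G v∈a))
      where
      off-a : ∀ e → e ≢ edge (bare P) a → incidence P v e ≡ 0
      off-a e e≢a = incidence≡0 λ { (j , e-spans) v∈e → e≢a (trans (spans⇒≡edge (bare P) e-spans)
        (cong (edge (bare P)) (only-a (subst (Incident G v) (spans⇒≡edge (bare P) e-spans) v∈e)))) }

    pathEnds-distinct : vs P zero ≢ vs P (fromℕ (suc (k P)))
    pathEnds-distinct eq with distinct P eq
    ... | ()

    sum-incidence : ∀ {v} → 3 ≤ deg G v → sum (incidence P v) ≡ hits v (pathEnds P)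
    sum-incidence {v} 3≤deg with any? (λ r → vs P r ≟ v)
    ... | no v∉P = trans (sum-incidence-off (λ r eq → v∉P (r , eq)))
                         (sym (¬endpoint⇒hits≡0 (pathEnds P) [ (λ eq → v∉P (_ , eq)) , (λ eq → v∉P (_ , eq)) ]′))
    ... | yes (r , refl) with position r
    ...   | inner t = ⊥-elim (<-irrefl (sym (innerDeg P t)) 3≤deg)
    ...   | start   = trans
      (sum-incidence-single zero (sameEnds⇒endpointˡ (edge-spans (bare P) zero)) (incident-start⇒≡0 (bare P)))
      (sym (endpoint⇒hits≡1 (pathEnds P) pathEnds-distinct (inj₁ refl)))
    ...   | end     = trans
      (sum-incidence-single (fromℕ (k P)) (sameEnds⇒endpointʳ (edge-spans (bare P) (fromℕ (k P))))
                            (incident-end⇒≡last (bare P)))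
      (sym (endpoint⇒hits≡1 (pathEnds P) pathEnds-distinct (inj₂ refl)))

    hits-pathEnds-low : ∀ {v} → ¬ 3 ≤ deg G v → hits v (pathEnds P) ≡ 0
    hits-pathEnds-low 3≰deg = ¬endpoint⇒hits≡0 (pathEnds P)
      [ (λ { refl → 3≰deg (startDeg P) }) , (λ { refl → 3≰deg (endDeg P) }) ]′

module _ {n m : ℕ} {G : SimpleGraph n m} (2conn : TwoConnected G) (m≢n : m ≢ n) where

  private
    chainOf : Fin m → ChainPath G
    chainOf e = proj₁ (chainThrough 2conn m≢n e)

    chainOf-∋ : ∀ e → InPath (chainOf e) e
    chainOf-∋ e = proj₂ (chainThrough 2conn m≢n e)

  private
    high? : ∀ v → Dec (3 ≤ deg G v)
    high? v = 3 ≤? deg G v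

  deg≡2⇒internal : ∀ {v} → deg G v ≡ 2 → ∃[ Q ] Internal Q v
  deg≡2⇒internal {v} deg≡2 with 0<deg⇒incident G (subst (0 <_) (sym deg≡2) z<s)
  ... | e , v∈e with inBarePath-endpoint (bare (chainOf e)) (chainOf-∋ e) v∈e
  ... | r , vᵣ≡v with position r
  ...   | start   = ⊥-elim (<-irrefl (sym (trans (cong (deg G) vᵣ≡v) deg≡2)) (startDeg (chainOf e)))
  ...   | end     = ⊥-elim (<-irrefl (sym (trans (cong (deg G) vᵣ≡v) deg≡2)) (endDeg (chainOf e)))
  ...   | inner t = chainOf e , t , vᵣ≡v

  3≤deg⇔¬internal : ∀ v → 3 ≤ deg G v ⇔ (∀ Q → ¬ Internal Q v)
  3≤deg⇔¬internal v = mk⇔ (λ 3≤deg Q v∈Q → <-irrefl (sym (internal⇒deg≡2 Q v∈Q)) 3≤deg) from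
    where
    from : (∀ Q → ¬ Internal Q v) → 3 ≤ deg G v
    from ¬internal with 3 ≤? deg G v
    ... | yes 3≤deg = 3≤deg
    ... | no 3≰deg  = ⊥-elim (uncurry ¬internal (deg≡2⇒internal (¬2<deg⇒deg≡2 G 2conn 3≰deg)))

  distillation : Distillation G
  distillation = record
    { chains         = deduplicate sameChain? (tabulate chainOf)
    ; chainsDistinct = λ _ _ _ _ → allPairs-At (λ {P} {Q} → IsEquivalence.sym sameChain-isEquivalence {P} {Q})
                                     (deduplicate-! chainDecSetoid (tabulate chainOf))
    ; chainsComplete = complete
    ; free           = []
    ; freeUnique     = []
    ; freeSpec       = λ e → mk⇔ (λ ()) (λ chainless → ⊥-elim (chainless (chainOf e) (chainOf-∋ e)))
    ; verts          = filter high? (allFin n)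
    ; vertsUnique    = filter⁺ high? (allFin⁺ n)
    ; vertsSpec      = λ v → ⇔.trans
                         (mk⇔ (proj₂ ∘ ∈-filter⁻ high? {xs = allFin n}) (∈-filter⁺ high? (∈-allFin v)))
                         (3≤deg⇔¬internal v)
    }
    where
    complete : ∀ Q → ∃[ P ] (P ∈ deduplicate sameChain? (tabulate chainOf) × SameChain P Q)
    complete Q = find (Any.deduplicate⁺ sameChain? (λ {X} {Y} → IsEquivalence.trans sameChain-isEquivalence {Y} {X} {Q})
      (Any.tabulate⁺ e₀ (shared-edge⇒sameChain (chainOf e₀) Q (chainOf-∋ e₀) (edge-inBarePath (bare Q) zero))))
      where
      e₀ : Fin m
      e₀ = edge (bare Q) zero

  module DistillationProperties (D : Distillation G) where

    free-empty : free D ≡ []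
    free-empty with free D | freeSpec D
    ... | []    | _    = refl
    ... | e ∷ _ | spec = ⊥-elim (Equivalence.to (spec e) (here refl) (chainOf e) (chainOf-∋ e))

    edgesD≡ : edgesD D ≡ map pathEnds (chains D)
    edgesD≡ = trans (cong (λ fs → map pathEnds (chains D) ++ map (ends G) fs) free-empty) (++-identityʳ _)

    numEdgesD≡numChains : numEdgesD D ≡ numChains D
    numEdgesD≡numChains = trans (cong length edgesD≡) (length-map pathEnds (chains D))

    degD≡ : ∀ v → degD D v ≡ List.sum (map (λ P → hits v (pathEnds P)) (chains D))
    degD≡ v = cong List.sum (trans (cong (map (hits v)) edgesD≡) (sym (map-∘ (chains D))))

    ∈verts⇔3≤deg : ∀ v → v ∈ verts D ⇔ 3 ≤ deg G v
    ∈verts⇔3≤deg v = ⇔.trans (vertsSpec D v) (⇔.sym (3≤deg⇔¬internal v))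

    each-edge-in-one-chain : ∀ e → List.sum (map (χ ∘ (λ P → inPath? P e)) (chains D)) ≡ 1
    each-edge-in-one-chain e with chainsComplete D (chainOf e)
    ... | P , P∈D , P~Q = sum-χ-unique (λ P → inPath? P e) (chains D)
      (lose P∈D (Equivalence.from (P~Q e) (chainOf-∋ e)))
      (λ {i} {j} {P} {Q} at-i at-j e∈P e∈Q → chainsDistinct D i j P Q at-i at-j (shared-edge⇒sameChain P Q e∈P e∈Q))

    degD-high : ∀ {v} → 3 ≤ deg G v → degD D v ≡ deg G v
    degD-high {v} 3≤deg = begin
      degD D v
        ≡⟨ degD≡ v ⟩
      List.sum (map (λ P → hits v (pathEnds P)) (chains D))
        ≡⟨ cong List.sum (map-cong (λ P → sum-incidence P 3≤deg) (chains D)) ⟨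
      List.sum (map (λ P → sum (incidence P v)) (chains D))
        ≡⟨ ∑-sum-map-comm (λ e P → incidence P v e) (chains D) ⟨
      sum (λ e → List.sum (map (λ P → incidence P v e) (chains D)))
        ≡⟨ sum-cong-≗ (λ e → sum-map-*ʳ _ (hits v (ends G e)) (chains D)) ⟩
      sum (λ e → List.sum (map (χ ∘ (λ P → inPath? P e)) (chains D)) * hits v (ends G e))
        ≡⟨ sum-cong-≗ (λ e → trans (cong (_* hits v (ends G e)) (each-edge-in-one-chain e)) (ℕ.*-identityˡ _)) ⟩
      sum (λ e → hits v (ends G e))
        ≡⟨ deg-≡-∑ G v ⟨
      deg G v
        ∎
      where open ≡-Reasoning

    degD-low : ∀ {v} → ¬ 3 ≤ deg G v → degD D v ≡ 0
    degD-low {v} 3≰deg = begin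
      degD D v
        ≡⟨ degD≡ v ⟩
      List.sum (map (λ P → hits v (pathEnds P)) (chains D))
        ≡⟨ cong List.sum (map-cong (λ P → hits-pathEnds-low P 3≰deg) (chains D)) ⟩
      List.sum (map (λ _ → 0) (chains D))
        ≡⟨ sum-map-const (chains D) 0 ⟩
      numChains D * 0
        ≡⟨ ℕ.*-zeroʳ (numChains D) ⟩
      0
        ∎
      where open ≡-Reasoning

    n₃ n₂ : ℕ
    n₃ = sum (λ v → χ (high? v))
    n₂ = sum (λ v → χ (¬? (high? v)))

    sum-degD : sum (degD D) ≡ numChains D * 2
    sum-degD = trans (handshake (edgesD D)) (cong (_* 2) numEdgesD≡numChains)

    n₃+n₂≡n : n₃ + n₂ ≡ n
    n₃+n₂≡n = begin
      n₃ + n₂                                          ≡⟨ ∑-distrib-+ (λ v → χ (high? v)) _ ⟨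
      sum (λ v → χ (high? v) + χ (¬? (high? v)))       ≡⟨ sum-cong-≗ (λ v → χ+χ¬ (high? v)) ⟩
      sum {n} (λ _ → 1)                                ≡⟨ sum-const n 1 ⟩
      n * 1                                            ≡⟨ ℕ.*-identityʳ n ⟩
      n                                                ∎
      where
      open ≡-Reasoning
      χ+χ¬ : {A : Set} (A? : Dec A) → χ A? + χ (¬? A?) ≡ 1
      χ+χ¬ (yes _) = refl
      χ+χ¬ (no _)  = refl

    m≡numChains+n₂ : m ≡ numChains D + n₂
    m≡numChains+n₂ = ℕ.*-cancelʳ-≡ m _ 2 (begin
      m * 2
        ≡⟨ sum-deg G ⟨
      sum (deg G)
        ≡⟨ sum-cong-≗ deg≡degD+2·low ⟩
      sum (λ v → degD D v + 2 * χ (¬? (high? v)))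
        ≡⟨ ∑-distrib-+ (degD D) _ ⟩
      sum (degD D) + sum (λ v → 2 * χ (¬? (high? v)))
        ≡⟨ cong₂ _+_ sum-degD (sym (*-distribˡ-sum 2 (λ v → χ (¬? (high? v))))) ⟩
      numChains D * 2 + 2 * n₂
        ≡⟨ cong (numChains D * 2 +_) (ℕ.*-comm 2 n₂) ⟩
      numChains D * 2 + n₂ * 2
        ≡⟨ ℕ.*-distribʳ-+ 2 (numChains D) n₂ ⟨
      (numChains D + n₂) * 2
        ∎)
      where
      open ≡-Reasoning
      deg≡degD+2·low : ∀ v → deg G v ≡ degD D v + 2 * χ (¬? (high? v))
      deg≡degD+2·low v with high? v
      ... | yes 3≤deg = trans (sym (degD-high 3≤deg)) (sym (ℕ.+-identityʳ _))
      ... | no 3≰deg  = trans (¬2<deg⇒deg≡2 G 2conn 3≰deg) (cong (_+ 2) (sym (degD-low 3≰deg)))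

    3·χ≤degD : ∀ v → 3 * χ (high? v) ≤ degD D v
    3·χ≤degD v with high? v
    ... | yes 3≤deg = subst (3 ≤_) (sym (degD-high 3≤deg)) 3≤deg
    ... | no _      = z≤n

    3·n₃≤sum-degD : 3 * n₃ ≤ sum (degD D)
    3·n₃≤sum-degD = subst (_≤ sum (degD D)) (sym (*-distribˡ-sum 3 (λ v → χ (high? v)))) (sum-mono-≤ 3·χ≤degD)

    minDegD≥3 : MinDegD≥3 D
    minDegD≥3 v v∈D = subst (3 ≤_) (sym (degD-high 3≤deg)) 3≤deg
      where
      3≤deg : 3 ≤ deg G v
      3≤deg = Equivalence.to (∈verts⇔3≤deg v) v∈D

    cubic⇔sum-degD≡3·n₃ : CubicD D ⇔ sum (degD D) ≡ 3 * n₃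
    cubic⇔sum-degD≡3·n₃ = mk⇔ to from
      where
      to : CubicD D → sum (degD D) ≡ 3 * n₃
      to cubic = trans (sum-cong-≗ pointwise) (sym (*-distribˡ-sum 3 (λ v → χ (high? v))))
        where
        pointwise : ∀ v → degD D v ≡ 3 * χ (high? v)
        pointwise v with high? v
        ... | yes 3≤deg = cubic v (Equivalence.from (∈verts⇔3≤deg v) 3≤deg)
        ... | no 3≰deg  = degD-low 3≰deg
      from : sum (degD D) ≡ 3 * n₃ → CubicD D
      from sum≡ v v∈D = begin
        degD D v              ≡⟨ ≤∧sum-≡⇒≡ 3·χ≤degD sums≡ v ⟨
        3 * χ (high? v)       ≡⟨ cong (3 *_) (χ-yes (high? v) (Equivalence.to (∈verts⇔3≤deg v) v∈D)) ⟩
        3                     ∎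
        where
        open ≡-Reasoning
        sums≡ : sum (λ v → 3 * χ (high? v)) ≡ sum (degD D)
        sums≡ = trans (sym (*-distribˡ-sum 3 (λ v → χ (high? v)))) (sym sum≡)

private
  [p+n]*2≡2p+2n : ∀ p n → (p + n) * 2 ≡ 2 * p + 2 * n
  [p+n]*2≡2p+2n = solve-∀

p+n≤3p : ∀ p n → 3 * n ≤ (p + n) * 2 → p + n ≤ 3 * p
p+n≤3p p n 3n≤2p+2n =
  +-monoʳ-≤ p (+-cancelʳ-≤ (2 * n) n (2 * p) (subst (3 * n ≤_) ([p+n]*2≡2p+2n p n) 3n≤2p+2n))

p+n≡3p⇔2p+2n≡3n : ∀ p n → p + n ≡ 3 * p ⇔ (p + n) * 2 ≡ 3 * n
p+n≡3p⇔2p+2n≡3n p n = mk⇔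
  (λ p+n≡3p → trans ([p+n]*2≡2p+2n p n) (cong (_+ 2 * n) (sym (+-cancelˡ-≡ p n (2 * p) p+n≡3p))))
  (λ 2p+2n≡3n → cong (p +_) (+-cancelʳ-≡ (2 * n) n (2 * p) (trans (sym 2p+2n≡3n) ([p+n]*2≡2p+2n p n))))

3p+i≢2p+i : ∀ p i → p ≢ 0 → 3 * p + i ≢ 2 * p + i
3p+i≢2p+i p i p≢0 eq = p≢0 (+-cancelʳ-≡ (2 * p) p 0 (+-cancelʳ-≡ i (3 * p) (2 * p) eq))

module Bounds {p i : ℕ} {G : SimpleGraph (2 * p + i) (3 * p + i)} (2conn : TwoConnected G) (p≢0 : p ≢ 0)
              (D : Distillation G) where

  open DistillationProperties 2conn (3p+i≢2p+i p i p≢0) D public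

  numChains≡p+n₃ : numChains D ≡ p + n₃
  numChains≡p+n₃ = +-cancelʳ-≡ n₂ _ _ (begin
    numChains D + n₂   ≡⟨ m≡numChains+n₂ ⟨
    p + 2 * p + i      ≡⟨ +-assoc p (2 * p) i ⟩
    p + (2 * p + i)    ≡⟨ cong (p +_) n₃+n₂≡n ⟨
    p + (n₃ + n₂)      ≡⟨ +-assoc p n₃ n₂ ⟨
    p + n₃ + n₂        ∎)
    where open ≡-Reasoning

  sum-degD≡[p+n₃]*2 : sum (degD D) ≡ (p + n₃) * 2
  sum-degD≡[p+n₃]*2 = trans sum-degD (cong (_* 2) numChains≡p+n₃)

  numChains≤3p : numChains D ≤ 3 * p
  numChains≤3p = subst (_≤ 3 * p) (sym numChains≡p+n₃)
    (p+n≤3p p n₃ (subst (3 * n₃ ≤_) sum-degD≡[p+n₃]*2 3·n₃≤sum-degD))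

  numChains≡3p⇔cubic : numChains D ≡ 3 * p ⇔ CubicD D
  numChains≡3p⇔cubic = begin
    numChains D ≡ 3 * p       ≡⟨ cong (_≡ 3 * p) numChains≡p+n₃ ⟩
    p + n₃ ≡ 3 * p            ≈⟨ p+n≡3p⇔2p+2n≡3n p n₃ ⟩
    (p + n₃) * 2 ≡ 3 * n₃     ≡⟨ cong (_≡ 3 * n₃) sum-degD≡[p+n₃]*2 ⟨
    sum (degD D) ≡ 3 * n₃     ≈⟨ cubic⇔sum-degD≡3·n₃ ⟨
    CubicD D                  ∎
    where open import Relation.Binary.Reasoning.Setoid (⇔.⇔-setoid 0ℓ)

  numEdgesD≤3p : numEdgesD D ≤ 3 * p
  numEdgesD≤3p = subst (_≤ 3 * p) (sym numEdgesD≡numChains) numChains≤3p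

  numEdgesD≡3p⇒cubic : numEdgesD D ≡ 3 * p → CubicD D
  numEdgesD≡3p⇒cubic = Equivalence.to numChains≡3p⇔cubic ∘ trans (sym numEdgesD≡numChains)

lemma4 : (p i : ℕ) → 2 ≤ p →
         (G : SimpleGraph (2 * p + i) (3 * p + i)) → Connected G → TwoConnected G →
         Distillation G ×
         ((D : Distillation G) →
            (numEdgesD D ≤ 3 * p × MinDegD≥3 D) ×
            (numEdgesD D ≡ 3 * p → CubicD D) ×
            (numChains D ≤ 3 * p × (numChains D ≡ 3 * p ⇔ CubicD D)))
-- Connectedness is already part of TwoConnected.
lemma4 p i 2≤p G _ 2conn = distillation 2conn (3p+i≢2p+i p i p≢0) , λ D →
  let open Bounds 2conn p≢0 D in
  (numEdgesD≤3p , minDegD≥3) , numEdgesD≡3p⇒cubic , numChains≤3p , numChains≡3p⇔cubic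
  where
  p≢0 : p ≢ 0
  p≢0 = ℕ.m<n⇒n≢0 2≤p
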